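{- Let $\alpha$ be a nondegenerate $d$-simplex in the $d$-cube, and let $\sigma$ and $\tau$ be nonempty exterior faces of $\alpha$. Let $j$ be the number of vertices that $\sigma$ and $\tau$ have in common and $k=|S_\sigma\cap S_\tau|$ the number of cube-face coordinates they have in common. Then: (i) if $j>0$ then $j=k+1$, and if $j=0$ then $k=0$; (ii) if $k\neq 0$, then the number of vertices of $\alpha$ belonging to neither $\sigma$ nor $\tau$ equals the number of coordinates in $\{1,\dots,d\}$ belonging to neither $S_\sigma$ nor $S_\tau$.
   Context: A nondegenerate $d$-simplex in the $d$-cube is the convex hull of $d+1$ affinely independent points of $\{0,1\}^d$. A $j$-face of the cube $[0,1]^d$ is obtained by fixing $d-j$ specified coordinates to specified values in $\{0,1\}$. A $j$-face of a simplex is the convex hull of $j+1$ of its vertices; it is exterior if it is contained in some $j$-face of the cube. For an exterior face $\tau$, its set of cube-face coordinates $S_\tau$ is the set of coordinates on which the vertices of $\tau$ are not all equal (for an exterior $j$-face, $|S_\tau|=j$). -}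

module Defs where

open import Data.Nat using (ℕ; zero; suc; _+_)
open import Data.Bool using (Bool; true; false; _∧_; _∨_; _xor_; if_then_else_)
open import Data.Fin using (Fin; zero; suc)
open import Data.Fin.Subset using (Subset; _∈_; ∣_∣)
open import Data.Vec using (tabulate; lookup)
open import Data.Product using (Σ; ∃; _×_)
open import Data.Rational using (ℚ; 0ℚ; 1ℚ) renaming (_+_ to _+ℚ_; _*_ to _*ℚ_)
open import Relation.Binary.PropositionalEquality using (_≡_)

Point : ℕ → Set
Point d = Fin d → Bool

-- A (d+1)-tuple of cube vertices, the vertex list of a candidate d-simplex.
Simplex : ℕ → Set
Simplex d = Fin (suc d) → Point d

sumℚ : ∀ {n} → (Fin n → ℚ) → ℚ
sumℚ {zero}  f = 0ℚ
sumℚ {suc n} f = f zero +ℚ sumℚ (λ i → f (suc i))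

bℚ : Bool → ℚ
bℚ b = if b then 1ℚ else 0ℚ

-- Affine independence (over ℚ, equivalently over ℝ for rational points):
-- the only affine dependence  Σ λ_a = 0, Σ λ_a v_a = 0  is trivial.
AffinelyIndependent : ∀ {d m} → (Fin m → Point d) → Set
AffinelyIndependent {d} {m} v =
  (λs : Fin m → ℚ) →
  sumℚ λs ≡ 0ℚ →
  (∀ (i : Fin d) → sumℚ (λ a → λs a *ℚ bℚ (v a i)) ≡ 0ℚ) →
  ∀ a → λs a ≡ 0ℚ

Nondegenerate : ∀ {d} → Simplex d → Set
Nondegenerate = AffinelyIndependent

anyFin : ∀ {n} → (Fin n → Bool) → Bool
anyFin {zero}  f = false
anyFin {suc n} f = f zero ∨ anyFin (λ i → f (suc i))

Face : ℕ → Set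
Face d = Subset (suc d)

InCubeFace : ∀ {d} → Simplex d → Face d → Subset d → Point d → Set
InCubeFace v τ F c = ∀ a → a ∈ τ → ∀ i → i ∈ F → v a i ≡ c i

-- τ is an exterior j-face: it has j+1 vertices and lies in some j-face of
-- the cube (d - j coordinates fixed to specified values).
Exterior : ∀ {d} → Simplex d → Face d → Set
Exterior {d} v τ =
  Σ ℕ λ j → (∣ τ ∣ ≡ suc j) ×
    Σ (Subset d) λ F → Σ (Point d) λ c → (∣ F ∣ + j ≡ d) × InCubeFace v τ F c

S : ∀ {d} → Simplex d → Face d → Subset d
S {d} v τ = tabulate λ i →
  anyFin λ a → anyFin λ b →
    (lookup τ a ∧ lookup τ b) ∧ (v a i xor v b i)

-- The vertices of a nondegenerate simplex are affinely independent, so a set of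
-- them contained in an affine subspace of dimension k has at most k + 1
-- elements (by Gaussian elimination over ℚ). The vertices of an
-- exterior face σ agree outside S_σ, i.e. lie in a translate of the coordinate
-- subspace ℝ^{S_σ}, and the cube face containing σ gives the opposite bound, so
-- |σ| = |S_σ| + 1. If σ and τ share a vertex, σ ∪ τ and σ ∩ τ lie in translates
-- of ℝ^{S_σ ∪ S_τ} and ℝ^{S_σ ∩ S_τ}; otherwise σ ∪ τ still lies in two parallel
-- translates of ℝ^{S_σ ∪ S_τ}, which span one more dimension. Inclusion–exclusion
-- gives |σ ∪ τ| + |σ ∩ τ| = (|S_σ ∪ S_τ| + 1) + (|S_σ ∩ S_τ| + 1), which forces
-- every one of these upper bounds that applies to be an equality; part (ii) is
-- |σ ∪ τ| = |S_σ ∪ S_τ| + 1 counted in the complements (d + 1 vertices, d coordinates).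
module Submission where

open import Defs
open import Data.Nat using (ℕ; suc; _>_)
open import Data.Fin.Subset using (Subset; ∣_∣; _∩_; _∪_; ∁; Nonempty)
open import Data.Product using (_×_)
open import Relation.Binary.PropositionalEquality using (_≡_; _≢_)

open import Algebra.Bundles using (CommutativeRing)
open import Data.Bool using (Bool; true; false; _∧_; _∨_; _xor_; if_then_else_)
open import Data.Bool.Properties using (∧-conicalˡ; ∧-conicalʳ; ∨-zeroʳ; xor-same)
import Data.Bool.Properties as Bool
open import Data.Fin using (Fin; zero; suc; _≟_; _↑ˡ_; _↑ʳ_; splitAt; join)
open import Data.Fin.Properties using (any?; join-splitAt)
open import Data.Fin.Subset using (_∈_; _∉_; _─_; ⁅_⁆; ⊤; inside; outside)
open import Data.Fin.Subset.Properties
  using ( _∈?_; nonempty?; Empty-unique; ∣⊥∣≡0; ∣⊤∣≡n; ∣∁p∣≡n∸∣p∣; ∣p∣≤∣x∷p∣; p⊆q⇒∣p∣≤∣q∣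
        ; p─⊥≡p; p─q⊆p; drop-there; x∉p⇒x∈∁p; x∈p∪q⁻; x∈p∪q⁺; x∈p∩q⁻; x∈p∩q⁺ )
open import Data.Nat as ℕ using (_≤_; _<_; _∸_; s≤s)
import Data.Nat.Properties as ℕ
open import Data.Product using (∃; ∃₂; _,_; proj₁; proj₂)
open import Data.Rational using (ℚ; 0ℚ; 1ℚ; _+_; _*_; -_; _-_; 1/_; ≢-nonZero)
import Data.Rational.Properties as ℚ
open import Data.Rational.Solver using (module +-*-Solver)
open import Data.Sum using (_⊎_; inj₁; inj₂)
open import Data.Vec as Vec using ([]; _∷_; here; there; lookup)
open import Data.Vec.Properties
  using (lookup⇒[]=; []=⇒lookup; lookup∘tabulate; lookup-++ˡ; lookup-++ʳ; lookup-replicate)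
import Data.Vec.Functional as Vector
import Data.Vec.Functional.Properties as Vector
open import Function using (_∘_)
open import Relation.Nullary using (Dec; ¬?; yes; no; does; contradiction)
open import Relation.Nullary.Decidable using (decidable-stable; dec-true; dec-false; _×-dec_)
open import Relation.Binary.PropositionalEquality using (refl; sym; trans; cong; cong₂; subst; module ≡-Reasoning)

open import Algebra.Properties.Semiring.Sum (CommutativeRing.semiring ℚ.+-*-commutativeRing)
  using (sum; sum-syntax; sum-cong-≗; sum-replicate-zero; ∑-distrib-+; *-distribˡ-sum; *-distribʳ-sum; ∑-comm)
open +-*-Solver

∑-zero : ∀ {n} {f : Fin n → ℚ} → (∀ i → f i ≡ 0ℚ) → sum f ≡ 0ℚ
∑-zero {n} f≗0 = trans (sum-cong-≗ f≗0) (sum-replicate-zero n)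

∑-+-* : ∀ {n} (c : ℚ) (f g : Fin n → ℚ) → ∑[ i < n ] (f i + c * g i) ≡ sum f + c * sum g
∑-+-* c f g = trans (∑-distrib-+ f (λ i → c * g i)) (cong (sum f +_) (sym (*-distribˡ-sum c g)))

δ : ∀ {n} → Fin n → Fin n → ℚ
δ a b = if does (a ≟ b) then 1ℚ else 0ℚ

δ-diag : ∀ {n} (a : Fin n) → δ a a ≡ 1ℚ
δ-diag a = cong (if_then 1ℚ else 0ℚ) (dec-true (a ≟ a) refl)

δ-≢ : ∀ {n} {a b : Fin n} → a ≢ b → δ a b ≡ 0ℚ
δ-≢ {a = a} {b} a≢b = cong (if_then 1ℚ else 0ℚ) (dec-false (a ≟ b) a≢b)

∑-δ : ∀ {n} (a : Fin n) (g : Fin n → ℚ) → ∑[ b < n ] (δ a b * g b) ≡ g a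
∑-δ zero g = begin
  1ℚ * g zero + ∑[ b < _ ] (0ℚ * g (suc b)) ≡⟨ cong₂ _+_ (ℚ.*-identityˡ (g zero)) (∑-zero (λ b → ℚ.*-zeroˡ (g (suc b)))) ⟩
  g zero + 0ℚ                                ≡⟨ ℚ.+-identityʳ (g zero) ⟩
  g zero                                     ∎
  where open ≡-Reasoning
∑-δ (suc a) g = begin
  0ℚ * g zero + ∑[ b < _ ] (δ a b * g (suc b)) ≡⟨ cong₂ _+_ (ℚ.*-zeroˡ (g zero)) (∑-δ a (g ∘ suc)) ⟩
  0ℚ + g (suc a)                               ≡⟨ ℚ.+-identityˡ (g (suc a)) ⟩
  g (suc a)                                    ∎
  where open ≡-Reasoning

sumℚ≡∑ : ∀ {n} (f : Fin n → ℚ) → sumℚ f ≡ sum f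
sumℚ≡∑ {ℕ.zero} f = refl
sumℚ≡∑ {suc n}  f = cong (f zero +_) (sumℚ≡∑ (f ∘ suc))

0<∣p∣⇒Nonempty : ∀ {n} (p : Subset n) → 0 < ∣ p ∣ → Nonempty p
0<∣p∣⇒Nonempty {n} p 0<∣p∣ with nonempty? p
... | yes p≢∅ = p≢∅
... | no  p≡∅ = contradiction (trans (cong ∣_∣ (Empty-unique p≡∅)) (∣⊥∣≡0 n)) (ℕ.n>0⇒n≢0 0<∣p∣)

x∉p─⁅x⁆ : ∀ {n} (p : Subset n) x → x ∉ p ─ ⁅ x ⁆
x∉p─⁅x⁆ (_ ∷ p) zero    ()
x∉p─⁅x⁆ (_ ∷ p) (suc x) (there x∈p─⁅x⁆) = x∉p─⁅x⁆ p x x∈p─⁅x⁆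

x∈p⇒∣p∣≡1+∣p─⁅x⁆∣ : ∀ {n} {p : Subset n} {x} → x ∈ p → ∣ p ∣ ≡ suc ∣ p ─ ⁅ x ⁆ ∣
x∈p⇒∣p∣≡1+∣p─⁅x⁆∣ {p = inside  ∷ p} here        = cong (suc ∘ ∣_∣) (sym (p─⊥≡p p))
x∈p⇒∣p∣≡1+∣p─⁅x⁆∣ {p = inside  ∷ p} (there x∈p) = cong suc (x∈p⇒∣p∣≡1+∣p─⁅x⁆∣ x∈p)
x∈p⇒∣p∣≡1+∣p─⁅x⁆∣ {p = outside ∷ p} (there x∈p) = x∈p⇒∣p∣≡1+∣p─⁅x⁆∣ x∈p

∣p++q∣≡∣p∣+∣q∣ : ∀ {m n} (p : Subset m) (q : Subset n) → ∣ p Vec.++ q ∣ ≡ ∣ p ∣ ℕ.+ ∣ q ∣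
∣p++q∣≡∣p∣+∣q∣ []            q = refl
∣p++q∣≡∣p∣+∣q∣ (inside  ∷ p) q = cong suc (∣p++q∣≡∣p∣+∣q∣ p q)
∣p++q∣≡∣p∣+∣q∣ (outside ∷ p) q = ∣p++q∣≡∣p∣+∣q∣ p q

∣p∪q∣+∣p∩q∣≡∣p∣+∣q∣ : ∀ {n} (p q : Subset n) → ∣ p ∪ q ∣ ℕ.+ ∣ p ∩ q ∣ ≡ ∣ p ∣ ℕ.+ ∣ q ∣
∣p∪q∣+∣p∩q∣≡∣p∣+∣q∣ []            []            = refl
∣p∪q∣+∣p∩q∣≡∣p∣+∣q∣ (inside  ∷ p) (inside  ∷ q) =
  cong suc (trans (ℕ.+-suc ∣ p ∪ q ∣ ∣ p ∩ q ∣) (trans (cong suc (∣p∪q∣+∣p∩q∣≡∣p∣+∣q∣ p q)) (sym (ℕ.+-suc ∣ p ∣ ∣ q ∣))))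
∣p∪q∣+∣p∩q∣≡∣p∣+∣q∣ (inside  ∷ p) (outside ∷ q) = cong suc (∣p∪q∣+∣p∩q∣≡∣p∣+∣q∣ p q)
∣p∪q∣+∣p∩q∣≡∣p∣+∣q∣ (outside ∷ p) (inside  ∷ q) = trans (cong suc (∣p∪q∣+∣p∩q∣≡∣p∣+∣q∣ p q)) (sym (ℕ.+-suc ∣ p ∣ ∣ q ∣))
∣p∪q∣+∣p∩q∣≡∣p∣+∣q∣ (outside ∷ p) (outside ∷ q) = ∣p∪q∣+∣p∩q∣≡∣p∣+∣q∣ p q

m≤n∧o≤p∧m+o≡n+p⇒m≡n×o≡p : ∀ {m n o p} → m ≤ n → o ≤ p → m ℕ.+ o ≡ n ℕ.+ p → m ≡ n × o ≡ p
m≤n∧o≤p∧m+o≡n+p⇒m≡n×o≡p {m} {n} {o} {p} m≤n o≤p m+o≡n+p =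
  m≡n , ℕ.+-cancelˡ-≡ n o p (trans (cong (ℕ._+ o) (sym m≡n)) m+o≡n+p)
  where
  m≡n : m ≡ n
  m≡n = ℕ.≤-antisym m≤n (ℕ.+-cancelʳ-≤ p n m (subst (_≤ m ℕ.+ p) m+o≡n+p (ℕ.+-monoʳ-≤ m o≤p)))

-- Linear dependence by Gaussian elimination

SupportedOn : ∀ {m n} → Subset m → Subset n → (Fin m → Fin n → ℚ) → Set
SupportedOn P C v = ∀ {a i} → a ∈ P → i ∉ C → v a i ≡ 0ℚ

record LinearDependence {m n} (P : Subset m) (v : Fin m → Fin n → ℚ) : Set where
  field
    coeff       : Fin m → ℚ
    coeff-out   : ∀ {a} → a ∉ P → coeff a ≡ 0ℚ
    combination : ∀ i → ∑[ a < m ] (coeff a * v a i) ≡ 0ℚ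
    witness     : Fin m
    witness≢0   : coeff witness ≢ 0ℚ

pivot? : ∀ {m} (P : Subset m) (f : Fin m → ℚ) →
         (∃ λ a → a ∈ P × f a ≢ 0ℚ) ⊎ (∀ {a} → a ∈ P → f a ≡ 0ℚ)
pivot? P f with any? (λ a → a ∈? P ×-dec ¬? (f a ℚ.≟ 0ℚ))
... | yes pivot = inj₁ pivot
... | no  ∄pivot = inj₂ λ {a} a∈P → decidable-stable (f a ℚ.≟ 0ℚ) (λ fa≢0 → ∄pivot (a , a∈P , fa≢0))

dependence-with-zero-column : ∀ {m n} {P : Subset m} (v : Fin m → Fin (suc n) → ℚ) →
                              (∀ {a} → a ∈ P → v a zero ≡ 0ℚ) →
                              LinearDependence P (λ a i → v a (suc i)) → LinearDependence P v
dependence-with-zero-column {P = P} v column≡0 dep = record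
  { coeff = coeff ; coeff-out = coeff-out ; combination = combination′
  ; witness = witness ; witness≢0 = witness≢0 }
  where
  open LinearDependence dep
  term≡0 : ∀ a → coeff a * v a zero ≡ 0ℚ
  term≡0 a with a ∈? P
  ... | yes a∈P = trans (cong (coeff a *_) (column≡0 a∈P)) (ℚ.*-zeroʳ (coeff a))
  ... | no  a∉P = trans (cong (_* v a zero) (coeff-out a∉P)) (ℚ.*-zeroˡ (v a zero))
  combination′ : ∀ i → ∑[ a < _ ] (coeff a * v a i) ≡ 0ℚ
  combination′ zero    = ∑-zero term≡0
  combination′ (suc i) = combination i

module _ {m n} (v : Fin m → Fin (suc n) → ℚ) (a : Fin m) (pivot⁻¹ : ℚ) where

  eliminate : Fin m → Fin n → ℚ
  eliminate b i = v b (suc i) - (v b zero * pivot⁻¹) * v a (suc i)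

  eliminate-supported : ∀ {P C} → SupportedOn P (inside ∷ C) v → a ∈ P → SupportedOn (P ─ ⁅ a ⁆) C eliminate
  eliminate-supported {P} supported a∈P {b} {i} b∈P─a i∉C = begin
    v b (suc i) - (v b zero * pivot⁻¹) * v a (suc i) ≡⟨ cong₂ (λ x y → x - (v b zero * pivot⁻¹) * y) (vanish b∈P) (vanish a∈P) ⟩
    0ℚ - (v b zero * pivot⁻¹) * 0ℚ                   ≡⟨ solve 1 (λ x → con 0ℚ :- x :* con 0ℚ := con 0ℚ) refl (v b zero * pivot⁻¹) ⟩
    0ℚ                                               ∎
    where
    open ≡-Reasoning
    vanish : ∀ {c} → c ∈ P → v c (suc i) ≡ 0ℚ
    vanish c∈P = supported c∈P (i∉C ∘ drop-there)
    b∈P = p─q⊆p P ⁅ a ⁆ b∈P─a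

  -- A dependence μ of the eliminated vectors becomes one of the original
  -- vectors once a multiple of e_a cancels the pivot column.
  dependence-after-elimination : ∀ {P} → a ∈ P → pivot⁻¹ * v a zero ≡ 1ℚ →
                                 LinearDependence (P ─ ⁅ a ⁆) eliminate → LinearDependence P v
  dependence-after-elimination {P} a∈P pivot⁻¹*pivot≡1 dep = record
    { coeff = coeff′ ; coeff-out = coeff′-out ; combination = combination′
    ; witness = witness ; witness≢0 = λ c≡0 → witness≢0 (trans (sym (coeff′-≢ a≢witness)) c≡0) }
    where
    open LinearDependence dep
    open ≡-Reasoning
    s : ℚ
    s = ∑[ b < m ] (coeff b * v b zero)
    t : ℚ
    t = - (s * pivot⁻¹)
    coeff′ : Fin m → ℚ
    coeff′ b = coeff b + t * δ a b
    coeff′-≢ : ∀ {b} → a ≢ b → coeff′ b ≡ coeff b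
    coeff′-≢ {b} a≢b = trans (cong (λ x → coeff b + t * x) (δ-≢ a≢b))
                             (solve 2 (λ x y → x :+ y :* con 0ℚ := x) refl (coeff b) t)
    a≢witness : a ≢ witness
    a≢witness a≡c = witness≢0 (coeff-out (subst (_∉ P ─ ⁅ a ⁆) a≡c (x∉p─⁅x⁆ P a)))
    coeff′-out : ∀ {b} → b ∉ P → coeff′ b ≡ 0ℚ
    coeff′-out {b} b∉P = trans (coeff′-≢ (λ a≡b → b∉P (subst (_∈ P) a≡b a∈P)))
                               (coeff-out (b∉P ∘ p─q⊆p P ⁅ a ⁆))
    ∑-coeff′ : ∀ g → ∑[ b < m ] (coeff′ b * g b) ≡ ∑[ b < m ] (coeff b * g b) + t * g a
    ∑-coeff′ g = begin
      ∑[ b < m ] (coeff′ b * g b)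
        ≡⟨ sum-cong-≗ (λ b → solve 4 (λ μ c d x → (μ :+ c :* d) :* x := μ :* x :+ c :* (d :* x)) refl (coeff b) t (δ a b) (g b)) ⟩
      ∑[ b < m ] (coeff b * g b + t * (δ a b * g b))
        ≡⟨ ∑-+-* t (λ b → coeff b * g b) (λ b → δ a b * g b) ⟩
      ∑[ b < m ] (coeff b * g b) + t * ∑[ b < m ] (δ a b * g b)
        ≡⟨ cong (λ x → ∑[ b < m ] (coeff b * g b) + t * x) (∑-δ a g) ⟩
      ∑[ b < m ] (coeff b * g b) + t * g a ∎
    combination′ : ∀ i → ∑[ b < m ] (coeff′ b * v b i) ≡ 0ℚ
    combination′ zero = begin
      ∑[ b < m ] (coeff′ b * v b zero) ≡⟨ ∑-coeff′ (λ b → v b zero) ⟩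
      s + t * v a zero                 ≡⟨ cong (s +_) (solve 3 (λ s q p → (:- (s :* q)) :* p := :- (s :* (q :* p))) refl s pivot⁻¹ (v a zero)) ⟩
      s + - (s * (pivot⁻¹ * v a zero)) ≡⟨ cong (λ x → s + - (s * x)) pivot⁻¹*pivot≡1 ⟩
      s + - (s * 1ℚ)                   ≡⟨ solve 1 (λ s → s :+ :- (s :* con 1ℚ) := con 0ℚ) refl s ⟩
      0ℚ                               ∎
    combination′ (suc i) = begin
      ∑[ b < m ] (coeff′ b * v b (suc i))
        ≡⟨ ∑-coeff′ (λ b → v b (suc i)) ⟩
      ∑[ b < m ] (coeff b * v b (suc i)) + t * v a (suc i)
        ≡⟨ cong (∑[ b < m ] (coeff b * v b (suc i)) +_) (solve 3 (λ s q x → (:- (s :* q)) :* x := (:- (q :* x)) :* s) refl s pivot⁻¹ (v a (suc i))) ⟩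
      ∑[ b < m ] (coeff b * v b (suc i)) + - (pivot⁻¹ * v a (suc i)) * s
        ≡⟨ sym (∑-+-* (- (pivot⁻¹ * v a (suc i))) (λ b → coeff b * v b (suc i)) (λ b → coeff b * v b zero)) ⟩
      ∑[ b < m ] (coeff b * v b (suc i) + - (pivot⁻¹ * v a (suc i)) * (coeff b * v b zero))
        ≡⟨ sum-cong-≗ (λ b → solve 5 (λ μ x y q z → μ :* x :+ (:- (q :* z)) :* (μ :* y) := μ :* (x :- (y :* q) :* z)) refl (coeff b) (v b (suc i)) (v b zero) pivot⁻¹ (v a (suc i))) ⟩
      ∑[ b < m ] (coeff b * eliminate b i)
        ≡⟨ combination i ⟩
      0ℚ ∎

linearDependence : ∀ {m n} (P : Subset m) (C : Subset n) (v : Fin m → Fin n → ℚ) →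
                   SupportedOn P C v → ∣ C ∣ < ∣ P ∣ → LinearDependence P v
linearDependence P [] v _ 0<∣P∣ with 0<∣p∣⇒Nonempty P 0<∣P∣
... | a , a∈P = record
  { coeff = δ a
  ; coeff-out = λ b∉P → δ-≢ (λ a≡b → b∉P (subst (_∈ P) a≡b a∈P))
  ; combination = λ ()
  ; witness = a
  ; witness≢0 = λ δaa≡0 → ℚ.1≢0 (trans (sym (δ-diag a)) δaa≡0) }
linearDependence P (c ∷ C) v supported ∣C∣<∣P∣ with pivot? P (λ a → v a zero)
... | inj₂ column≡0 =
  dependence-with-zero-column v column≡0
    (linearDependence P C (λ a i → v a (suc i)) (λ a∈P i∉C → supported a∈P (i∉C ∘ drop-there))
                      (ℕ.≤-<-trans (∣p∣≤∣x∷p∣ c C) ∣C∣<∣P∣))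
... | inj₁ (a , a∈P , pivot≢0) with c
...   | outside = contradiction (supported a∈P λ ()) pivot≢0
...   | inside  =
  dependence-after-elimination v a (1/ pivot) a∈P (ℚ.*-inverseˡ pivot)
    (linearDependence (P ─ ⁅ a ⁆) C (eliminate v a (1/ pivot)) (eliminate-supported v a (1/ pivot) supported a∈P)
                      (ℕ.s<s⁻¹ (subst (suc ∣ C ∣ <_) (x∈p⇒∣p∣≡1+∣p─⁅x⁆∣ a∈P) ∣C∣<∣P∣)))
  where
  pivot = v a zero
  instance _ = ≢-nonZero pivot≢0

-- Affinely independent points on translates of a coordinate subspace

-- Vertex a lies on the translate p (κ a) + ℝ^T.
LieOnTranslates : ∀ {m d r} → (Fin m → Point d) → Subset m → Subset d → (Fin r → Point d) → (Fin m → Fin r) → Set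
LieOnTranslates v Q T p κ = ∀ {a i} → a ∈ Q → i ∉ T → v a i ≡ p (κ a) i

module _ {m d r} (v : Fin m → Point d) (p : Fin r → Point d) (κ : Fin m → Fin r) where

  -- The linear map (c , y) ↦ (∑ c , ∑ₖ c k · p k + y) sends lifted a to (1 , v a),
  -- so linear dependences of the lifted vectors are affine dependences of the v a.
  lifted : Fin m → Fin (r ℕ.+ d) → ℚ
  lifted a = δ (κ a) Vector.++ λ i → bℚ (v a i) - bℚ (p (κ a) i)

  lifted-supported : ∀ {Q T} → LieOnTranslates v Q T p κ → SupportedOn Q (⊤ Vec.++ T) lifted
  lifted-supported {Q} {T} on {a} {i} a∈Q i∉C =
    subst (λ j → j ∉ ⊤ Vec.++ T → lifted a j ≡ 0ℚ) (join-splitAt r d i) (by-block (splitAt r i)) i∉C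
    where
    open ≡-Reasoning
    by-block : ∀ s → join r d s ∉ ⊤ Vec.++ T → lifted a (join r d s) ≡ 0ℚ
    by-block (inj₁ k) k∉C = contradiction (lookup⇒[]= _ (⊤ Vec.++ T) (trans (lookup-++ˡ ⊤ T k) (lookup-replicate k inside))) k∉C
    by-block (inj₂ j) j∉C = begin
      lifted a (r ↑ʳ j)               ≡⟨ Vector.lookup-++ʳ (δ (κ a)) _ j ⟩
      bℚ (v a j) - bℚ (p (κ a) j)     ≡⟨ cong (λ b → bℚ b - bℚ (p (κ a) j)) (on a∈Q (j∉C ∘ ∈T⇒∈C)) ⟩
      bℚ (p (κ a) j) - bℚ (p (κ a) j) ≡⟨ ℚ.+-inverseʳ (bℚ (p (κ a) j)) ⟩
      0ℚ                              ∎
      where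
      ∈T⇒∈C : j ∈ T → r ↑ʳ j ∈ ⊤ Vec.++ T
      ∈T⇒∈C j∈T = lookup⇒[]= _ (⊤ Vec.++ T) (trans (lookup-++ʳ (⊤ {r}) T j) ([]=⇒lookup j∈T))

  lifted-dependence⇒affine : ∀ (λs : Fin m → ℚ) → (∀ j → ∑[ a < m ] (λs a * lifted a j) ≡ 0ℚ) →
                             sumℚ λs ≡ 0ℚ × (∀ i → sumℚ (λ a → λs a * bℚ (v a i)) ≡ 0ℚ)
  lifted-dependence⇒affine λs combination = sum≡0 , moment≡0
    where
    open ≡-Reasoning
    class-sum≡0 : ∀ k → ∑[ a < m ] (λs a * δ (κ a) k) ≡ 0ℚ
    class-sum≡0 k = trans (sum-cong-≗ (λ a → cong (λs a *_) (sym (Vector.lookup-++ˡ (δ (κ a)) _ k)))) (combination (k ↑ˡ d))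
    offset-sum≡0 : ∀ i → ∑[ a < m ] (λs a * (bℚ (v a i) - bℚ (p (κ a) i))) ≡ 0ℚ
    offset-sum≡0 i = trans (sum-cong-≗ (λ a → cong (λs a *_) (sym (Vector.lookup-++ʳ (δ (κ a)) _ i)))) (combination (r ↑ʳ i))
    base-sum≡0 : ∀ (x : Fin r → ℚ) → ∑[ a < m ] (λs a * x (κ a)) ≡ 0ℚ
    base-sum≡0 x = begin
      ∑[ a < m ] (λs a * x (κ a))
        ≡⟨ sum-cong-≗ (λ a → trans (cong (λs a *_) (sym (∑-δ (κ a) x))) (*-distribˡ-sum (λs a) (λ k → δ (κ a) k * x k))) ⟩
      ∑[ a < m ] ∑[ k < r ] (λs a * (δ (κ a) k * x k))
        ≡⟨ ∑-comm (λ a k → λs a * (δ (κ a) k * x k)) ⟩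
      ∑[ k < r ] ∑[ a < m ] (λs a * (δ (κ a) k * x k))
        ≡⟨ sum-cong-≗ (λ k → trans (sum-cong-≗ (λ a → sym (ℚ.*-assoc (λs a) (δ (κ a) k) (x k))))
                                    (sym (*-distribʳ-sum (x k) (λ a → λs a * δ (κ a) k)))) ⟩
      ∑[ k < r ] (∑[ a < m ] (λs a * δ (κ a) k) * x k)
        ≡⟨ ∑-zero (λ k → trans (cong (_* x k) (class-sum≡0 k)) (ℚ.*-zeroˡ (x k))) ⟩
      0ℚ ∎
    sum≡0 : sumℚ λs ≡ 0ℚ
    sum≡0 = begin
      sumℚ λs                ≡⟨ sumℚ≡∑ λs ⟩
      sum λs                 ≡⟨ sum-cong-≗ (λ a → sym (ℚ.*-identityʳ (λs a))) ⟩
      ∑[ a < m ] (λs a * 1ℚ) ≡⟨ base-sum≡0 (λ _ → 1ℚ) ⟩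
      0ℚ                     ∎
    moment≡0 : ∀ i → sumℚ (λ a → λs a * bℚ (v a i)) ≡ 0ℚ
    moment≡0 i = begin
      sumℚ (λ a → λs a * bℚ (v a i))
        ≡⟨ sumℚ≡∑ (λ a → λs a * bℚ (v a i)) ⟩
      ∑[ a < m ] (λs a * bℚ (v a i))
        ≡⟨ sum-cong-≗ (λ a → solve 3 (λ l x y → l :* x := l :* (x :- y) :+ l :* y) refl (λs a) (bℚ (v a i)) (bℚ (p (κ a) i))) ⟩
      ∑[ a < m ] (λs a * (bℚ (v a i) - bℚ (p (κ a) i)) + λs a * bℚ (p (κ a) i))
        ≡⟨ ∑-distrib-+ (λ a → λs a * (bℚ (v a i) - bℚ (p (κ a) i))) (λ a → λs a * bℚ (p (κ a) i)) ⟩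
      ∑[ a < m ] (λs a * (bℚ (v a i) - bℚ (p (κ a) i))) + ∑[ a < m ] (λs a * bℚ (p (κ a) i))
        ≡⟨ cong₂ _+_ (offset-sum≡0 i) (base-sum≡0 (λ k → bℚ (p k i))) ⟩
      0ℚ + 0ℚ
        ≡⟨ ℚ.+-identityˡ 0ℚ ⟩
      0ℚ ∎

  ∣Q∣≤r+∣T∣ : AffinelyIndependent v → ∀ {Q T} → LieOnTranslates v Q T p κ → ∣ Q ∣ ≤ r ℕ.+ ∣ T ∣
  ∣Q∣≤r+∣T∣ independent {Q} {T} on with ∣ Q ∣ ℕ.≤? r ℕ.+ ∣ T ∣
  ... | yes ∣Q∣≤r+∣T∣ = ∣Q∣≤r+∣T∣
  ... | no  ∣Q∣≰r+∣T∣ = contradiction (independent coeff (proj₁ affine) (proj₂ affine) witness) witness≢0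
    where
    ∣C∣≡r+∣T∣ : ∣ ⊤ {r} Vec.++ T ∣ ≡ r ℕ.+ ∣ T ∣
    ∣C∣≡r+∣T∣ = trans (∣p++q∣≡∣p∣+∣q∣ (⊤ {r}) T) (cong (ℕ._+ ∣ T ∣) (∣⊤∣≡n r))
    open LinearDependence (linearDependence Q (⊤ Vec.++ T) lifted (lifted-supported on)
                                            (subst (_< ∣ Q ∣) (sym ∣C∣≡r+∣T∣) (ℕ.≰⇒> ∣Q∣≰r+∣T∣)))
    affine = lifted-dependence⇒affine coeff combination

∣Q∣≤1+∣T∣ : ∀ {m d} (v : Fin m → Point d) → AffinelyIndependent v → ∀ {Q T} (x : Point d) →
            (∀ {a i} → a ∈ Q → i ∉ T → v a i ≡ x i) → ∣ Q ∣ ≤ suc ∣ T ∣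
∣Q∣≤1+∣T∣ v independent x = ∣Q∣≤r+∣T∣ v (λ _ → x) (λ _ → zero {0}) independent

-- Exterior faces

anyFin⁺ : ∀ {n} (f : Fin n → Bool) {a} → f a ≡ true → anyFin f ≡ true
anyFin⁺ f {zero}  fa≡true = cong (_∨ anyFin (f ∘ suc)) fa≡true
anyFin⁺ f {suc a} fa≡true = trans (cong (f zero ∨_) (anyFin⁺ (f ∘ suc) fa≡true)) (∨-zeroʳ (f zero))

anyFin⁻ : ∀ {n} (f : Fin n → Bool) → anyFin f ≡ true → ∃ λ a → f a ≡ true
anyFin⁻ {suc n} f any≡true with f zero in f0≡b
... | true  = zero , f0≡b
... | false with anyFin⁻ (f ∘ suc) any≡true
...   | a , fa≡true = suc a , fa≡true

xor≡true⇒≢ : ∀ {x y} → x xor y ≡ true → x ≢ y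
xor≡true⇒≢ {x} xor≡true refl = contradiction (trans (sym xor≡true) (xor-same x)) λ ()

≢⇒xor≡true : ∀ {x y} → x ≢ y → x xor y ≡ true
≢⇒xor≡true {false} {false} x≢y = contradiction refl x≢y
≢⇒xor≡true {false} {true}  x≢y = refl
≢⇒xor≡true {true}  {false} x≢y = refl
≢⇒xor≡true {true}  {true}  x≢y = contradiction refl x≢y

module _ {d} (α : Simplex d) (σ : Face d) where

  private
    varies : Fin d → Fin (suc d) → Fin (suc d) → Bool
    varies i a b = (lookup σ a ∧ lookup σ b) ∧ (α a i xor α b i)

    lookup-S : ∀ i → lookup (S α σ) i ≡ anyFin λ a → anyFin (varies i a)
    lookup-S = lookup∘tabulate (λ i → anyFin λ a → anyFin (varies i a))

  ∈S⁺ : ∀ {a b i} → a ∈ σ → b ∈ σ → α a i ≢ α b i → i ∈ S α σ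
  ∈S⁺ {a} {b} {i} a∈σ b∈σ αai≢αbi = lookup⇒[]= i (S α σ) (trans (lookup-S i)
    (anyFin⁺ (λ a → anyFin (varies i a)) {a} (anyFin⁺ (varies i a)
      (cong₂ _∧_ (cong₂ _∧_ ([]=⇒lookup a∈σ) ([]=⇒lookup b∈σ)) (≢⇒xor≡true αai≢αbi)))))

  ∈S⁻ : ∀ {i} → i ∈ S α σ → ∃₂ λ a b → a ∈ σ × b ∈ σ × α a i ≢ α b i
  ∈S⁻ {i} i∈S with anyFin⁻ (λ a → anyFin (varies i a)) (trans (sym (lookup-S i)) ([]=⇒lookup i∈S))
  ... | a , any≡true with anyFin⁻ (varies i a) any≡true
  ...   | b , varies≡true =
    a , b , lookup⇒[]= a σ (∧-conicalˡ _ _ both) , lookup⇒[]= b σ (∧-conicalʳ _ _ both) ,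
    xor≡true⇒≢ (∧-conicalʳ _ _ varies≡true)
    where both = ∧-conicalˡ _ _ varies≡true

  ∉S⇒≡ : ∀ {a b i} → a ∈ σ → b ∈ σ → i ∉ S α σ → α a i ≡ α b i
  ∉S⇒≡ {a} {b} {i} a∈σ b∈σ i∉S with α a i Bool.≟ α b i
  ... | yes αai≡αbi = αai≡αbi
  ... | no  αai≢αbi = contradiction (∈S⁺ a∈σ b∈σ αai≢αbi) i∉S

  exterior⇒∣S∣<∣σ∣ : Exterior α σ → ∣ S α σ ∣ < ∣ σ ∣
  exterior⇒∣S∣<∣σ∣ (j , ∣σ∣≡1+j , F , c , ∣F∣+j≡d , inFace) =
    subst (∣ S α σ ∣ <_) (sym ∣σ∣≡1+j) (s≤s ∣S∣≤j)
    where
    ∈S⇒∉F : ∀ {i} → i ∈ S α σ → i ∉ F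
    ∈S⇒∉F i∈S i∈F with ∈S⁻ i∈S
    ... | a , b , a∈σ , b∈σ , αai≢αbi = αai≢αbi (trans (inFace a a∈σ _ i∈F) (sym (inFace b b∈σ _ i∈F)))
    ∣S∣≤j : ∣ S α σ ∣ ≤ j
    ∣S∣≤j = begin
      ∣ S α σ ∣           ≤⟨ p⊆q⇒∣p∣≤∣q∣ (x∉p⇒x∈∁p ∘ ∈S⇒∉F) ⟩
      ∣ ∁ F ∣             ≡⟨ ∣∁p∣≡n∸∣p∣ F ⟩
      d ∸ ∣ F ∣           ≡⟨ cong (_∸ ∣ F ∣) (sym ∣F∣+j≡d) ⟩
      ∣ F ∣ ℕ.+ j ∸ ∣ F ∣ ≡⟨ ℕ.m+n∸m≡n ∣ F ∣ j ⟩
      j                   ∎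
      where open ℕ.≤-Reasoning

module _ {d} (α : Simplex d) (independent : Nondegenerate α) where

  ∣σ∣≡1+∣S∣ : ∀ {σ} → Nonempty σ → Exterior α σ → ∣ σ ∣ ≡ suc ∣ S α σ ∣
  ∣σ∣≡1+∣S∣ {σ} (z , z∈σ) exterior =
    ℕ.≤-antisym (∣Q∣≤1+∣T∣ α independent (α z) λ a∈σ i∉S → ∉S⇒≡ α σ a∈σ z∈σ i∉S)
                (exterior⇒∣S∣<∣σ∣ α σ exterior)

  ∣σ∪τ∣≤1+∣Sσ∪Sτ∣ : ∀ {σ τ z} → z ∈ σ → z ∈ τ → ∣ σ ∪ τ ∣ ≤ suc ∣ S α σ ∪ S α τ ∣
  ∣σ∪τ∣≤1+∣Sσ∪Sτ∣ {σ} {τ} {z} z∈σ z∈τ = ∣Q∣≤1+∣T∣ α independent (α z) on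
    where
    on : ∀ {a i} → a ∈ σ ∪ τ → i ∉ S α σ ∪ S α τ → α a i ≡ α z i
    on a∈σ∪τ i∉S with x∈p∪q⁻ σ τ a∈σ∪τ
    ... | inj₁ a∈σ = ∉S⇒≡ α σ a∈σ z∈σ (i∉S ∘ x∈p∪q⁺ ∘ inj₁)
    ... | inj₂ a∈τ = ∉S⇒≡ α τ a∈τ z∈τ (i∉S ∘ x∈p∪q⁺ ∘ inj₂)

  ∣σ∩τ∣≤1+∣Sσ∩Sτ∣ : ∀ {σ τ z} → z ∈ σ ∩ τ → ∣ σ ∩ τ ∣ ≤ suc ∣ S α σ ∩ S α τ ∣
  ∣σ∩τ∣≤1+∣Sσ∩Sτ∣ {σ} {τ} {z} z∈σ∩τ = ∣Q∣≤1+∣T∣ α independent (α z) on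
    where
    on : ∀ {a i} → a ∈ σ ∩ τ → i ∉ S α σ ∩ S α τ → α a i ≡ α z i
    on {a} {i} a∈σ∩τ i∉S with x∈p∩q⁻ σ τ a∈σ∩τ | x∈p∩q⁻ σ τ z∈σ∩τ | i ∈? S α σ
    ... | _   , a∈τ | _   , z∈τ | yes i∈Sσ = ∉S⇒≡ α τ a∈τ z∈τ (λ i∈Sτ → i∉S (x∈p∩q⁺ (i∈Sσ , i∈Sτ)))
    ... | a∈σ , _   | z∈σ , _   | no  i∉Sσ = ∉S⇒≡ α σ a∈σ z∈σ i∉Sσ

  ∣σ∪τ∣≤2+∣Sσ∪Sτ∣ : ∀ {σ τ z w} → z ∈ σ → w ∈ τ → ∣ σ ∪ τ ∣ ≤ 2 ℕ.+ ∣ S α σ ∪ S α τ ∣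
  ∣σ∪τ∣≤2+∣Sσ∪Sτ∣ {σ} {τ} {z} {w} z∈σ w∈τ = ∣Q∣≤r+∣T∣ α base side independent on
    where
    side : Fin (suc d) → Fin 2
    side a = if does (a ∈? σ) then zero else suc zero
    base : Fin 2 → Point d
    base zero    = α z
    base (suc _) = α w
    on : LieOnTranslates α (σ ∪ τ) (S α σ ∪ S α τ) base side
    on {a} {i} a∈σ∪τ i∉S = by-side (a ∈? σ)
      where
      by-side : (a∈?σ : Dec (a ∈ σ)) → α a i ≡ base (if does a∈?σ then zero else suc zero) i
      by-side (yes a∈σ) = ∉S⇒≡ α σ a∈σ z∈σ (i∉S ∘ x∈p∪q⁺ ∘ inj₁)
      by-side (no  a∉σ) with x∈p∪q⁻ σ τ a∈σ∪τ
      ... | inj₁ a∈σ = contradiction a∈σ a∉σ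
      ... | inj₂ a∈τ = ∉S⇒≡ α τ a∈τ w∈τ (i∉S ∘ x∈p∪q⁺ ∘ inj₂)

module ExteriorFacePair {d} (α : Simplex d) (independent : Nondegenerate α) {σ τ : Face d}
                       (σ≢∅ : Nonempty σ) (τ≢∅ : Nonempty τ) (σ-exterior : Exterior α σ) (τ-exterior : Exterior α τ) where

  ∣σ∪τ∣+∣σ∩τ∣≡1+∣Sσ∪Sτ∣+1+∣Sσ∩Sτ∣ : ∣ σ ∪ τ ∣ ℕ.+ ∣ σ ∩ τ ∣ ≡ suc ∣ S α σ ∪ S α τ ∣ ℕ.+ suc ∣ S α σ ∩ S α τ ∣
  ∣σ∪τ∣+∣σ∩τ∣≡1+∣Sσ∪Sτ∣+1+∣Sσ∩Sτ∣ = begin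
    ∣ σ ∪ τ ∣ ℕ.+ ∣ σ ∩ τ ∣                           ≡⟨ ∣p∪q∣+∣p∩q∣≡∣p∣+∣q∣ σ τ ⟩
    ∣ σ ∣ ℕ.+ ∣ τ ∣                                   ≡⟨ cong₂ ℕ._+_ (∣σ∣≡1+∣S∣ α independent σ≢∅ σ-exterior) (∣σ∣≡1+∣S∣ α independent τ≢∅ τ-exterior) ⟩
    suc ∣ S α σ ∣ ℕ.+ suc ∣ S α τ ∣                   ≡⟨ cong suc (ℕ.+-suc ∣ S α σ ∣ ∣ S α τ ∣) ⟩
    suc (suc (∣ S α σ ∣ ℕ.+ ∣ S α τ ∣))               ≡⟨ cong (λ n → suc (suc n)) (sym (∣p∪q∣+∣p∩q∣≡∣p∣+∣q∣ (S α σ) (S α τ))) ⟩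
    suc (suc (∣ S α σ ∪ S α τ ∣ ℕ.+ ∣ S α σ ∩ S α τ ∣)) ≡⟨ cong suc (sym (ℕ.+-suc ∣ S α σ ∪ S α τ ∣ ∣ S α σ ∩ S α τ ∣)) ⟩
    suc ∣ S α σ ∪ S α τ ∣ ℕ.+ suc ∣ S α σ ∩ S α τ ∣   ∎
    where open ≡-Reasoning

  ∣σ∩τ∣>0⇒∣σ∪τ∣≡1+∣Sσ∪Sτ∣×∣σ∩τ∣≡1+∣Sσ∩Sτ∣ : ∣ σ ∩ τ ∣ > 0 →
                                              ∣ σ ∪ τ ∣ ≡ suc ∣ S α σ ∪ S α τ ∣ × ∣ σ ∩ τ ∣ ≡ suc ∣ S α σ ∩ S α τ ∣
  ∣σ∩τ∣>0⇒∣σ∪τ∣≡1+∣Sσ∪Sτ∣×∣σ∩τ∣≡1+∣Sσ∩Sτ∣ ∣σ∩τ∣>0 with 0<∣p∣⇒Nonempty (σ ∩ τ) ∣σ∩τ∣>0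
  ... | y , y∈σ∩τ = m≤n∧o≤p∧m+o≡n+p⇒m≡n×o≡p
    (∣σ∪τ∣≤1+∣Sσ∪Sτ∣ α independent (proj₁ (x∈p∩q⁻ σ τ y∈σ∩τ)) (proj₂ (x∈p∩q⁻ σ τ y∈σ∩τ)))
    (∣σ∩τ∣≤1+∣Sσ∩Sτ∣ α independent y∈σ∩τ)
    ∣σ∪τ∣+∣σ∩τ∣≡1+∣Sσ∪Sτ∣+1+∣Sσ∩Sτ∣

  ∣σ∩τ∣≡0⇒∣Sσ∩Sτ∣≡0 : ∣ σ ∩ τ ∣ ≡ 0 → ∣ S α σ ∩ S α τ ∣ ≡ 0
  ∣σ∩τ∣≡0⇒∣Sσ∩Sτ∣≡0 ∣σ∩τ∣≡0 = ℕ.n≤0⇒n≡0 (ℕ.s≤s⁻¹ (ℕ.+-cancelˡ-≤ (suc ∣ S α σ ∪ S α τ ∣) _ 1 (begin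
    suc ∣ S α σ ∪ S α τ ∣ ℕ.+ suc ∣ S α σ ∩ S α τ ∣ ≡⟨ sym ∣σ∪τ∣+∣σ∩τ∣≡1+∣Sσ∪Sτ∣+1+∣Sσ∩Sτ∣ ⟩
    ∣ σ ∪ τ ∣ ℕ.+ ∣ σ ∩ τ ∣                         ≡⟨ cong (∣ σ ∪ τ ∣ ℕ.+_) ∣σ∩τ∣≡0 ⟩
    ∣ σ ∪ τ ∣ ℕ.+ 0                                 ≡⟨ ℕ.+-identityʳ ∣ σ ∪ τ ∣ ⟩
    ∣ σ ∪ τ ∣                                       ≤⟨ ∣σ∪τ∣≤2+∣Sσ∪Sτ∣ α independent (proj₂ σ≢∅) (proj₂ τ≢∅) ⟩
    2 ℕ.+ ∣ S α σ ∪ S α τ ∣                         ≡⟨ ℕ.+-comm 1 (suc ∣ S α σ ∪ S α τ ∣) ⟩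
    suc ∣ S α σ ∪ S α τ ∣ ℕ.+ 1                     ∎)))
    where open ℕ.≤-Reasoning

mainTheorem10 : ∀ {d : ℕ} (α : Simplex d) → Nondegenerate α →
    (σ τ : Face d) → Nonempty σ → Nonempty τ → Exterior α σ → Exterior α τ →
    ((∣ σ ∩ τ ∣ > 0 → ∣ σ ∩ τ ∣ ≡ suc ∣ S α σ ∩ S α τ ∣)
    × (∣ σ ∩ τ ∣ ≡ 0 → ∣ S α σ ∩ S α τ ∣ ≡ 0))
    × (∣ S α σ ∩ S α τ ∣ ≢ 0 → ∣ ∁ (σ ∪ τ) ∣ ≡ ∣ ∁ (S α σ ∪ S α τ) ∣)
mainTheorem10 {d} α independent σ τ σ≢∅ τ≢∅ σ-exterior τ-exterior =
  (proj₂ ∘ ∣σ∩τ∣>0⇒∣σ∪τ∣≡1+∣Sσ∪Sτ∣×∣σ∩τ∣≡1+∣Sσ∩Sτ∣ , ∣σ∩τ∣≡0⇒∣Sσ∩Sτ∣≡0) , complements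
  where
  open ExteriorFacePair α independent σ≢∅ τ≢∅ σ-exterior τ-exterior
  open ≡-Reasoning
  complements : ∣ S α σ ∩ S α τ ∣ ≢ 0 → ∣ ∁ (σ ∪ τ) ∣ ≡ ∣ ∁ (S α σ ∪ S α τ) ∣
  complements ∣Sσ∩Sτ∣≢0 = begin
    ∣ ∁ (σ ∪ τ) ∣         ≡⟨ ∣∁p∣≡n∸∣p∣ (σ ∪ τ) ⟩
    suc d ∸ ∣ σ ∪ τ ∣     ≡⟨ cong (suc d ∸_) (proj₁ (∣σ∩τ∣>0⇒∣σ∪τ∣≡1+∣Sσ∪Sτ∣×∣σ∩τ∣≡1+∣Sσ∩Sτ∣ ∣σ∩τ∣>0)) ⟩
    d ∸ ∣ S α σ ∪ S α τ ∣ ≡⟨ sym (∣∁p∣≡n∸∣p∣ (S α σ ∪ S α τ)) ⟩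
    ∣ ∁ (S α σ ∪ S α τ) ∣ ∎
    where
    ∣σ∩τ∣>0 : ∣ σ ∩ τ ∣ > 0
    ∣σ∩τ∣>0 = ℕ.n≢0⇒n>0 (∣Sσ∩Sτ∣≢0 ∘ ∣σ∩τ∣≡0⇒∣Sσ∩Sτ∣≡0)
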